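{- Let $\Lambda_{24}(1)$ be the set of 196560 minimal vectors of the Leech lattice normalized to unit vectors on $S^{23}$, and let $X$ be any subset containing exactly one vector from each antipodal pair (so $|X|=98280$), with no assumption on the sum of $X$. Define relations $R_0=\{(x,x)\}$ and $R_1,R_2,R_3,R_4,R_5$ on $X$ by $\langle x,y\rangle=0,\tfrac14,-\tfrac14,\tfrac12,-\tfrac12$ respectively. Then $(X,\{R_i\}_{0\le i\le5})$ is not an association scheme (of class 5).
   Context: Inner products between distinct non-antipodal normalized minimal vectors of the Leech lattice lie in $\{0,\pm\frac14,\pm\frac12\}$, so these relations partition $X\times X$. An association scheme of class $d$ on $X$ is a partition of $X\times X$ into relations $R_0=\{(x,x)\},R_1,\dots,R_d$, each closed under transposition, such that for all $i,j,k$ and all $(x,y)\in R_k$ the number $p_{ij}^k=|\{z\in X\mid (x,z)\in R_i,(z,y)\in R_j\}|$ depends only on $i,j,k$. -}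

module Defs where

open import Data.Bool using (Bool; true; false; _∧_; _xor_; if_then_else_; T)
open import Data.Nat as ℕ using (ℕ; _≡ᵇ_; _%_; _∸_)
open import Data.Fin using (Fin; zero; suc; toℕ)
open import Data.Integer using (ℤ; +_; -[1+_]; _-_; -_) renaming (_+_ to _+ℤ_; _*_ to _*ℤ_)
open import Data.Integer.Divisibility using (_∣_)
open import Data.List using (List; []; _∷_; length)
open import Data.Bool.ListAction using (any)
open import Data.List.Relation.Unary.Unique.Propositional using (Unique)
open import Data.List.Membership.Propositional using (_∈_)
open import Data.Vec using (Vec; lookup; foldr; zipWith; map; allFin)
open import Data.Product using (Σ; _×_; _,_)
open import Data.Sum using (_⊎_)
open import Relation.Binary.PropositionalEquality using (_≡_)
open import Relation.Nullary using (¬_)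
open import Function.Bundles using (_⇔_)

Cong : ℕ → ℤ → ℤ → Set
Cong n a b = (+ n) ∣ (a - b)

-- The extended binary Golay code C₂₄, realised as the extended
-- quadratic-residue code of length 24 (p = 23).
-- Coordinates 0..22 are ℤ/23, coordinate 23 is the parity ("∞") coordinate.

-- {0} ∪ (quadratic residues mod 23)
QR0 : List ℕ
QR0 = 0 ∷ 1 ∷ 2 ∷ 3 ∷ 4 ∷ 6 ∷ 8 ∷ 9 ∷ 12 ∷ 13 ∷ 16 ∷ 18 ∷ []

qrRow : ℕ → ℕ → Bool
qrRow s i = any (λ q → ((i ℕ.+ 23 ∸ s) % 23) ≡ᵇ q) QR0

qrParity : ℕ → Bool
qrParity s = foldr (λ _ → Bool) (λ i b → qrRow s (toℕ i) xor b) false (allFin 23)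

golayGen : Fin 24 → Fin 24 → Bool
golayGen s i =
  if toℕ s ≡ᵇ 23 then true
  else (if toℕ i ≡ᵇ 23 then qrParity (toℕ s) else qrRow (toℕ s) (toℕ i))

golayWord : (Fin 24 → Bool) → Fin 24 → Bool
golayWord c i = foldr (λ _ → Bool) (λ s b → (c s ∧ golayGen s i) xor b) false (allFin 24)

InGolay : (Fin 24 → Set) → Set
InGolay S = Σ (Fin 24 → Bool) λ c → ∀ i → S i ⇔ T (golayWord c i)

-- The Leech lattice, in the standard coordinates scaled by √8
-- (Conway–Sloane, SPLAG ch. 4, §11): x ∈ ℤ²⁴ lies in Λ₂₄ iff for some
-- m ∈ {0,1} all xᵢ ≡ m (mod 2) and Σ xᵢ ≡ 4m (mod 8), and for every k the
-- set {i | xᵢ ≡ k (mod 4)} is a Golay codeword.  Minimal vectors have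
-- x·x = 32 (i.e. norm 4 in the usual scaling).

Vec24 : Set
Vec24 = Vec ℤ 24

dot : Vec24 → Vec24 → ℤ
dot x y = foldr (λ _ → ℤ) _+ℤ_ (+ 0) (zipWith _*ℤ_ x y)

coordSum : Vec24 → ℤ
coordSum x = foldr (λ _ → ℤ) _+ℤ_ (+ 0) x

neg : Vec24 → Vec24
neg = map (λ a → - a)

InLeech : Vec24 → Set
InLeech x =
  (((∀ i → Cong 2 (lookup x i) (+ 0)) × Cong 8 (coordSum x) (+ 0))
   ⊎ ((∀ i → Cong 2 (lookup x i) (+ 1)) × Cong 8 (coordSum x) (+ 4)))
  × (∀ (k : ℤ) → InGolay (λ i → Cong 4 (lookup x i) k))

LeechMin : Vec24 → Set
LeechMin x = InLeech x × dot x x ≡ + 32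

HasSize : {A : Set} → (A → Set) → ℕ → Set
HasSize {A} P n = Σ (List A) λ l → Unique l × (∀ z → (z ∈ l) ⇔ P z) × length l ≡ n

IsAssociationScheme : {A : Set} (X : A → Set) (d : ℕ) (R : Fin (ℕ.suc d) → A → A → Set) → Set
IsAssociationScheme {A} X d R =
  (∀ x y → X x → X y → R zero x y ⇔ (x ≡ y))
  × (∀ x y → X x → X y → Σ (Fin (ℕ.suc d)) λ i → R i x y × (∀ j → R j x y → j ≡ i))
  × (∀ i x y → X x → X y → R i x y → R i y x)
  × (∀ i j k → Σ ℕ λ p → ∀ x y → X x → X y → R k x y →
        HasSize (λ z → X z × R i x z × R j z y) p)

-- The relations of Proposition 3.3.  With normalised vectors x/√32,
-- ⟨x,y⟩ = dot x y / 32, so ⟨x,y⟩ = 0, 1/4, -1/4, 1/2, -1/2 correspond to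
-- dot x y = 0, 8, -8, 16, -16.

leechRel : Fin 6 → Vec24 → Vec24 → Set
leechRel zero x y = x ≡ y
leechRel (suc zero) x y = dot x y ≡ + 0
leechRel (suc (suc zero)) x y = dot x y ≡ + 8
leechRel (suc (suc (suc zero))) x y = dot x y ≡ - (+ 8)
leechRel (suc (suc (suc (suc zero)))) x y = dot x y ≡ + 16
leechRel (suc (suc (suc (suc (suc zero))))) x y = dot x y ≡ - (+ 16)

IsAntipodalHalf : (Vec24 → Set) → Set
IsAntipodalHalf X =
  (∀ x → X x → LeechMin x)
  × (∀ x → LeechMin x → (X x ⊎ X (neg x)) × ¬ (X x × X (neg x)))

-- Take x, y ∈ X with ⟨x,y⟩ = 1/2 such that x − y is again a minimal vector.  Then
-- (x,y) and (y,x) both lie in R₄, and a vector z of norm 1 with ⟨x,z⟩ = 1/2 and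
-- ⟨z,y⟩ = −1/2 must be x − y, because ‖z − (x − y)‖² = 0.  So p⁴₄₅ counts
-- x − y ∈ X when read off (x,y) and its antipode y − x ∈ X when read off (y,x);
-- exactly one of the two lies in X.  Such a pair exists: among the minimal vectors
-- 4(e₀ + e₁), 4(e₀ + e₂), 4(e₀ + e₃), two are represented in X with the same sign.
module Submission where

open import Defs
open import Relation.Nullary using (¬_)

open import Data.Bool using (false; _∨_; if_then_else_)
open import Data.Empty using (⊥-elim)
open import Data.Fin using (Fin; #_; toℕ) renaming (zero to fzero; _≟_ to _≟ᶠ_)
import Data.Fin.Properties as Fin
open import Data.Integer using (ℤ; +_; -[1+_]; 0ℤ; _≟_; _+_; _-_; _*_; -_; ∣_∣)
open import Data.Integer.Properties
  using (*-comm; +-minus-telescope; neg-distrib-+; neg-involutive; +-comm;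
         +◃n≡+n; +-injective; ∣-i∣≡∣i∣; ∣i∣≡0⇒i≡0; i-j≡0⇒i≡j)
import Data.Integer.Divisibility.Signed as Signed
open import Data.Integer.Tactic.RingSolver using (solve-∀)
open import Data.List using ([]; _∷_)
open import Data.List.Relation.Unary.Any using (here)
open import Data.Nat as ℕ using (ℕ; suc; _≡ᵇ_)
import Data.Nat.Divisibility as ℕ
import Data.Nat.Properties as ℕ
open import Data.Product using (Σ; ∃₂; _×_; _,_; proj₁; proj₂)
open import Data.Sum using (_⊎_; inj₁; inj₂; [_,_]′)
open import Data.Unit using (tt)
open import Data.Vec using (Vec; []; _∷_; foldr; zipWith; lookup; tabulate; map)
open import Function.Base using (id)
open import Function.Bundles using (mk⇔; Equivalence)
open import Relation.Binary.PropositionalEquality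
open import Relation.Nullary.Decidable using (True; toWitness; yes; no; ⌊_⌋)

private
  variable
    n : ℕ

infixl 6 _-ᵥ_

_-ᵥ_ : Vec ℤ n → Vec ℤ n → Vec ℤ n
_-ᵥ_ = zipWith _-_

dotₙ : Vec ℤ n → Vec ℤ n → ℤ
dotₙ x y = foldr (λ _ → ℤ) _+_ 0ℤ (zipWith _*_ x y)

neg-minus : ∀ a b → - (a - b) ≡ b - a
neg-minus a b = begin
  - (a - b)    ≡⟨ neg-distrib-+ a (- b) ⟩
  - a + - - b  ≡⟨ cong (λ t → - a + t) (neg-involutive b) ⟩
  - a + b      ≡⟨ +-comm (- a) b ⟩
  b - a        ∎
  where open ≡-Reasoning

map-neg-minus : (x y : Vec ℤ n) → map -_ (x -ᵥ y) ≡ y -ᵥ x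
map-neg-minus []      []      = refl
map-neg-minus (a ∷ x) (b ∷ y) = cong₂ _∷_ (neg-minus a b) (map-neg-minus x y)

dotₙ-comm : (x y : Vec ℤ n) → dotₙ x y ≡ dotₙ y x
dotₙ-comm []      []      = refl
dotₙ-comm (a ∷ x) (b ∷ y) = cong₂ _+_ (*-comm a b) (dotₙ-comm x y)

dotₙ-distribˡ--ᵥ : (x y z : Vec ℤ n) → dotₙ x (y -ᵥ z) ≡ dotₙ x y - dotₙ x z
dotₙ-distribˡ--ᵥ []      []      []      = refl
dotₙ-distribˡ--ᵥ (a ∷ x) (b ∷ y) (c ∷ z) rewrite dotₙ-distribˡ--ᵥ x y z =
  step a b c (dotₙ x y) (dotₙ x z)
  where
  step : ∀ a b c s t → a * (b - c) + (s - t) ≡ (a * b + s) - (a * c + t)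
  step = solve-∀

dotₙ-distribʳ--ᵥ : (x y z : Vec ℤ n) → dotₙ (x -ᵥ y) z ≡ dotₙ x z - dotₙ y z
dotₙ-distribʳ--ᵥ x y z = begin
  dotₙ (x -ᵥ y) z        ≡⟨ dotₙ-comm (x -ᵥ y) z ⟩
  dotₙ z (x -ᵥ y)        ≡⟨ dotₙ-distribˡ--ᵥ z x y ⟩
  dotₙ z x - dotₙ z y    ≡⟨ cong₂ _-_ (dotₙ-comm z x) (dotₙ-comm z y) ⟩
  dotₙ x z - dotₙ y z    ∎
  where open ≡-Reasoning

dotₙ-self-minus : (x y : Vec ℤ n) →
  dotₙ (x -ᵥ y) (x -ᵥ y) ≡ dotₙ x x - + 2 * dotₙ x y + dotₙ y y
dotₙ-self-minus x y = begin
  dotₙ (x -ᵥ y) (x -ᵥ y)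
    ≡⟨ dotₙ-distribʳ--ᵥ x y (x -ᵥ y) ⟩
  dotₙ x (x -ᵥ y) - dotₙ y (x -ᵥ y)
    ≡⟨ cong₂ _-_ (dotₙ-distribˡ--ᵥ x x y) (dotₙ-distribˡ--ᵥ y x y) ⟩
  (dotₙ x x - dotₙ x y) - (dotₙ y x - dotₙ y y)
    ≡⟨ cong (λ t → (dotₙ x x - dotₙ x y) - (t - dotₙ y y)) (dotₙ-comm y x) ⟩
  (dotₙ x x - dotₙ x y) - (dotₙ x y - dotₙ y y)
    ≡⟨ collect (dotₙ x x) (dotₙ x y) (dotₙ y y) ⟩
  dotₙ x x - + 2 * dotₙ x y + dotₙ y y ∎
  where
  open ≡-Reasoning
  collect : ∀ p q r → (p - q) - (q - r) ≡ p - + 2 * q + r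
  collect = solve-∀

square≡∣∣² : ∀ a → a * a ≡ + (∣ a ∣ ℕ.* ∣ a ∣)
square≡∣∣² (+ m)     = +◃n≡+n (m ℕ.* m)
square≡∣∣² -[1+ m ] = +◃n≡+n (suc m ℕ.* suc m)

sumOfSquares : Vec ℤ n → ℕ
sumOfSquares = foldr (λ _ → ℕ) (λ a s → ∣ a ∣ ℕ.* ∣ a ∣ ℕ.+ s) 0

dotₙ-self≡sumOfSquares : (x : Vec ℤ n) → dotₙ x x ≡ + sumOfSquares x
dotₙ-self≡sumOfSquares []      = refl
dotₙ-self≡sumOfSquares (a ∷ x) = cong₂ _+_ (square≡∣∣² a) (dotₙ-self≡sumOfSquares x)

sumOfSquares-minus≡0⇒≡ : (x y : Vec ℤ n) → sumOfSquares (x -ᵥ y) ≡ 0 → x ≡ y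
sumOfSquares-minus≡0⇒≡ []      []      _  = refl
sumOfSquares-minus≡0⇒≡ (a ∷ x) (b ∷ y) eq =
  cong₂ _∷_ (i-j≡0⇒i≡j a b (∣i∣≡0⇒i≡0 ([ id , id ]′ (ℕ.m*n≡0⇒m≡0∨n≡0 _ (ℕ.m+n≡0⇒m≡0 _ eq)))))
            (sumOfSquares-minus≡0⇒≡ x y (ℕ.m+n≡0⇒n≡0 _ eq))

dotₙ-self-minus≡0⇒≡ : (x y : Vec ℤ n) → dotₙ (x -ᵥ y) (x -ᵥ y) ≡ 0ℤ → x ≡ y
dotₙ-self-minus≡0⇒≡ x y eq =
  sumOfSquares-minus≡0⇒≡ x y (+-injective (trans (sym (dotₙ-self≡sumOfSquares (x -ᵥ y))) eq))

≡-minus-by-inner-products : ∀ a (x y z : Vec ℤ n) →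
  dotₙ x x ≡ + 2 * a → dotₙ y y ≡ + 2 * a → dotₙ z z ≡ + 2 * a →
  dotₙ x y ≡ a → dotₙ x z ≡ a → dotₙ z y ≡ - a → z ≡ x -ᵥ y
≡-minus-by-inner-products a x y z xx yy zz xy xz zy =
  dotₙ-self-minus≡0⇒≡ z (x -ᵥ y) (begin
    dotₙ (z -ᵥ (x -ᵥ y)) (z -ᵥ (x -ᵥ y))
      ≡⟨ dotₙ-self-minus z (x -ᵥ y) ⟩
    dotₙ z z - + 2 * dotₙ z (x -ᵥ y) + dotₙ (x -ᵥ y) (x -ᵥ y)
      ≡⟨ cong₂ (λ s t → dotₙ z z - + 2 * s + t) (dotₙ-distribˡ--ᵥ z x y) (dotₙ-self-minus x y) ⟩
    dotₙ z z - + 2 * (dotₙ z x - dotₙ z y) + (dotₙ x x - + 2 * dotₙ x y + dotₙ y y)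
      ≡⟨ vanishes zz (trans (dotₙ-comm z x) xz) zy xx xy yy ⟩
    0ℤ ∎)
  where
  open ≡-Reasoning
  cancel : ∀ a → + 2 * a - + 2 * (a - - a) + (+ 2 * a - + 2 * a + + 2 * a) ≡ 0ℤ
  cancel = solve-∀
  vanishes : ∀ {zz zx zy xx xy yy} → zz ≡ + 2 * a → zx ≡ a → zy ≡ - a →
    xx ≡ + 2 * a → xy ≡ a → yy ≡ + 2 * a →
    zz - + 2 * (zx - zy) + (xx - + 2 * xy + yy) ≡ 0ℤ
  vanishes refl refl refl refl refl refl = cancel a

Cong-sym : ∀ {m} a b → Cong m a b → Cong m b a
Cong-sym {m} a b =
  subst (m ℕ.∣_) (trans (sym (∣-i∣≡∣i∣ (a - b))) (cong ∣_∣ (neg-minus a b)))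

Cong-trans : ∀ {m} a b c → Cong m a b → Cong m b c → Cong m a c
Cong-trans {m} a b c a≡b b≡c = Signed.∣⇒∣ᵤ
  (subst (+ m Signed.∣_) (+-minus-telescope a b c)
    (Signed.∣m∣n⇒∣m+n {m = a - b} {n = b - c} (Signed.∣ᵤ⇒∣ a≡b) (Signed.∣ᵤ⇒∣ b≡c)))

Cong-∣ : ∀ {k m} a b → k ℕ.∣ m → Cong m a b → Cong k a b
Cong-∣ a b = ℕ.∣-trans

-- The last generator of the code is the all-ones word.
InGolay-all : ∀ {S} → (∀ i → S i) → InGolay S
InGolay-all all = (λ s → toℕ s ≡ᵇ 23) , λ i → mk⇔ (λ _ → tt) (λ _ → all i)

InGolay-none : ∀ {S} → (∀ i → ¬ S i) → InGolay S
InGolay-none none = (λ _ → false) , λ i → mk⇔ (λ Sᵢ → ⊥-elim (none i Sᵢ)) (λ ())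

-- All coordinates lie in one class mod 4, so each Golay condition asks for the full
-- or the empty word.
multiplesOf4-InLeech : (x : Vec24) → (∀ i → Cong 4 (lookup x i) 0ℤ) →
  Cong 8 (coordSum x) 0ℤ → InLeech x
multiplesOf4-InLeech x four eight =
  inj₁ ((λ i → Cong-∣ (lookup x i) 0ℤ (ℕ.divides 2 refl) (four i)) , eight) , golay
  where
  golay : ∀ k → InGolay (λ i → Cong 4 (lookup x i) k)
  golay k with 4 ℕ.∣? ∣ 0ℤ - k ∣
  ... | yes 0≡k = InGolay-all λ i → Cong-trans (lookup x i) 0ℤ k (four i) 0≡k
  ... | no  0≢k = InGolay-none λ i xᵢ≡k →
    0≢k (Cong-trans 0ℤ (lookup x i) k (Cong-sym (lookup x i) 0ℤ (four i)) xᵢ≡k)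

multiplesOf4-LeechMin : (x : Vec24) →
  {True (Fin.all? λ i → 4 ℕ.∣? ∣ lookup x i - 0ℤ ∣)} →
  {True (8 ℕ.∣? ∣ coordSum x - 0ℤ ∣)} → {True (dot x x ≟ + 32)} → LeechMin x
multiplesOf4-LeechMin x {four} {eight} {thirtyTwo} =
  multiplesOf4-InLeech x (toWitness four) (toWitness eight) , toWitness thirtyTwo

HasSize-empty : ∀ {A : Set} {P : A → Set} {p} → HasSize P p → (∀ z → ¬ P z) → p ≡ 0
HasSize-empty ([]    , _ , _   , size) _     = sym size
HasSize-empty (z ∷ _ , _ , mem , _)    empty = ⊥-elim (empty z (Equivalence.to (mem z) (here refl)))

HasSize-inhabited : ∀ {A : Set} {P : A → Set} {p z} → HasSize P p → P z → ¬ p ≡ 0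
HasSize-inhabited {z = z} ([] , _ , mem , _) Pz _ with Equivalence.from (mem z) Pz
... | ()
HasSize-inhabited (_ ∷ _ , _ , _ , refl) _ ()

R₄Pair : (Vec24 → Set) → Set
R₄Pair X = ∃₂ λ x y → X x × X y × dot x y ≡ + 16 × LeechMin (x -ᵥ y)

module _ {X : Vec24 → Set} (half : IsAntipodalHalf X) where

  norm : ∀ {x} → X x → dot x x ≡ + 32
  norm Xx = proj₂ (proj₁ half _ Xx)

  one-of-antipodes : ∀ {x} → LeechMin x → X x ⊎ X (neg x)
  one-of-antipodes {x} minimal = proj₁ (proj₂ half x minimal)

  not-both-antipodes : ∀ {x} → X x → ¬ X (neg x)
  not-both-antipodes {x} Xx X-x = proj₂ (proj₂ half x (proj₁ half x Xx)) (Xx , X-x)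

  sameSide-R₄Pair : (u v : Vec24) → dot u v ≡ + 16 → dot (neg u) (neg v) ≡ + 16 →
    LeechMin (u -ᵥ v) → LeechMin (neg u -ᵥ neg v) →
    X u × X v ⊎ X (neg u) × X (neg v) → R₄Pair X
  sameSide-R₄Pair u v uv _ u-v _ (inj₁ (Xu , Xv)) = u , v , Xu , Xv , uv , u-v
  sameSide-R₄Pair u v _ uv _ u-v (inj₂ (Xu , Xv)) = neg u , neg v , Xu , Xv , uv , u-v

  module _ (scheme : IsAssociationScheme X 5 leechRel) where

    Between : Vec24 → Vec24 → Vec24 → Set
    Between x y z = X z × leechRel (# 4) x z × leechRel (# 5) z y

    intersection : Σ ℕ λ p → ∀ x y → X x → X y → leechRel (# 4) x y →
      HasSize (Between x y) p
    intersection = proj₂ (proj₂ (proj₂ scheme)) (# 4) (# 5) (# 4)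

    Between⇒≡ : ∀ {x y z} → X x → X y → dot x y ≡ + 16 → Between x y z → z ≡ x -ᵥ y
    Between⇒≡ {x} {y} {z} Xx Xy xy (Xz , xz , zy) =
      ≡-minus-by-inner-products (+ 16) x y z (norm Xx) (norm Xy) (norm Xz) xy xz zy

    Between-minus : ∀ {x y} → X x → X y → dot x y ≡ + 16 → X (x -ᵥ y) → Between x y (x -ᵥ y)
    Between-minus {x} {y} Xx Xy xy Xw =
        Xw
      , trans (dotₙ-distribˡ--ᵥ x x y) (cong₂ _-_ (norm Xx) xy)
      , trans (dotₙ-distribʳ--ᵥ x y y) (cong₂ _-_ xy (norm Xy))

    minus-∉ : ∀ {x y} → X x → X y → dot x y ≡ + 16 → ¬ X (x -ᵥ y)
    minus-∉ {x} {y} Xx Xy xy Xw = HasSize-inhabited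
      (count x y Xx Xy xy) (Between-minus Xx Xy xy Xw)
      (HasSize-empty (count y x Xy Xx yx) λ z between →
        not-both-antipodes Xw
          (subst X (trans (Between⇒≡ Xy Xx yx between) (sym (map-neg-minus x y))) (proj₁ between)))
      where
      count : ∀ x y → X x → X y → dot x y ≡ + 16 → HasSize (Between x y) (proj₁ intersection)
      count = proj₂ intersection
      yx : dot y x ≡ + 16
      yx = trans (dotₙ-comm y x) xy

    R₄Pair-absurd : ¬ R₄Pair X
    R₄Pair-absurd (x , y , Xx , Xy , xy , minimal) with one-of-antipodes minimal
    ... | inj₁ Xw  = minus-∉ Xx Xy xy Xw
    ... | inj₂ X-w = minus-∉ Xy Xx (trans (dotₙ-comm y x) xy) (subst X (map-neg-minus x y) X-w)

pigeonhole : {A₁ B₁ A₂ B₂ A₃ B₃ : Set} → A₁ ⊎ B₁ → A₂ ⊎ B₂ → A₃ ⊎ B₃ →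
  (A₁ × A₂ ⊎ B₁ × B₂) ⊎ (A₁ × A₃ ⊎ B₁ × B₃) ⊎ (A₂ × A₃ ⊎ B₂ × B₃)
pigeonhole (inj₁ a₁) (inj₁ a₂) _         = inj₁ (inj₁ (a₁ , a₂))
pigeonhole (inj₂ b₁) (inj₂ b₂) _         = inj₁ (inj₂ (b₁ , b₂))
pigeonhole (inj₁ a₁) (inj₂ _)  (inj₁ a₃) = inj₂ (inj₁ (inj₁ (a₁ , a₃)))
pigeonhole (inj₁ _)  (inj₂ b₂) (inj₂ b₃) = inj₂ (inj₂ (inj₂ (b₂ , b₃)))
pigeonhole (inj₂ _)  (inj₁ a₂) (inj₁ a₃) = inj₂ (inj₂ (inj₁ (a₂ , a₃)))
pigeonhole (inj₂ b₁) (inj₁ _)  (inj₂ b₃) = inj₂ (inj₁ (inj₂ (b₁ , b₃)))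

spike : Fin 24 → Vec24
spike j = tabulate λ i → if ⌊ i ≟ᶠ fzero ⌋ ∨ ⌊ i ≟ᶠ j ⌋ then + 4 else 0ℤ

proposition3p3 : (X : Vec24 → Set) → IsAntipodalHalf X →
                 ¬ IsAssociationScheme X 5 leechRel
proposition3p3 X half scheme = R₄Pair-absurd half scheme
  ([ pair₁₂ , [ pair₁₃ , pair₂₃ ]′ ]′ (pigeonhole (side v₁) (side v₂) (side v₃)))
  where
  v₁ v₂ v₃ : Vec24
  v₁ = spike (# 1)
  v₂ = spike (# 2)
  v₃ = spike (# 3)

  side : (v : Vec24) → {True (Fin.all? λ i → 4 ℕ.∣? ∣ lookup v i - 0ℤ ∣)} →
    {True (8 ℕ.∣? ∣ coordSum v - 0ℤ ∣)} → {True (dot v v ≟ + 32)} → X v ⊎ X (neg v)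
  side v {four} {eight} {thirtyTwo} =
    one-of-antipodes half (multiplesOf4-LeechMin v {four} {eight} {thirtyTwo})

  pair₁₂ : X v₁ × X v₂ ⊎ X (neg v₁) × X (neg v₂) → R₄Pair X
  pair₁₂ = sameSide-R₄Pair half v₁ v₂ refl refl
    (multiplesOf4-LeechMin (v₁ -ᵥ v₂)) (multiplesOf4-LeechMin (neg v₁ -ᵥ neg v₂))

  pair₁₃ : X v₁ × X v₃ ⊎ X (neg v₁) × X (neg v₃) → R₄Pair X
  pair₁₃ = sameSide-R₄Pair half v₁ v₃ refl refl
    (multiplesOf4-LeechMin (v₁ -ᵥ v₃)) (multiplesOf4-LeechMin (neg v₁ -ᵥ neg v₃))

  pair₂₃ : X v₂ × X v₃ ⊎ X (neg v₂) × X (neg v₃) → R₄Pair X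
  pair₂₃ = sameSide-R₄Pair half v₂ v₃ refl refl
    (multiplesOf4-LeechMin (v₂ -ᵥ v₃)) (multiplesOf4-LeechMin (neg v₂ -ᵥ neg v₃))
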